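{- Let $n\ge1$, $0\le m\le n-1$, and let $K$ be an acyclic pure $n$-simplicial complex. Let $\sigma_i,\sigma_j$ be $m$-simplices of $K$ and let $W_x$ and $W_y$ be reduced $(m,n)$-path sequences between $\sigma_i$ and $\sigma_j$ with corresponding reduced simplicial paths $P_x$ and $P_y$, such that $W_x$ is dependent on $W_y$. Then: (1) if $m=n-1$, then $W_x=W_y$; (2) if $m<n-1$, then $P_x=P_y$.
   Context: A simplicial complex on a finite vertex set is a collection of non-empty vertex subsets containing all singletons and closed under non-empty subsets; a $k$-simplex has $k+1$ vertices; $\tau$ is a face of $\sigma$ if $\tau\subseteq\sigma$. $K$ is a pure $n$-simplicial complex if $\dim K=n$ and every simplex is a face of some $n$-simplex. For a set $S$ of simplices, $\overline{S}$ is the set of all faces of members of $S$. An $(m,n)$-walk sequence between $m$-simplices $\sigma,\sigma'$ is an alternating sequence $\sigma=\sigma_1,\eta_1,\sigma_2,\dots,\sigma_r,\eta_r,\sigma_{r+1}=\sigma'$ of $m$-simplices $\sigma_k$ and $n$-simplices $\eta_k$ with $\sigma_k\ne\sigma_{k+1}$ both faces of $\eta_k$; it is an $(m,n)$-path sequence if all its simplices are distinct. An $(m,n)$-path sequence is reduced if (i) among $\eta_1,\dots,\eta_r$, $\sigma_1$ is a face only of $\eta_1$ and $\sigma_{r+1}$ is a face only of $\eta_r$; (ii) for each $2\le z\le r$ there is an $(n-1)$-simplex $\sigma'_z$ of $K$ which is a face of both $\eta_{z-1}$ and $\eta_z$ and has $\sigma_z$ as a face, with $\sigma'_x\neq\sigma'_y$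 for $2\le x\ne y\le r$. Its reduced simplicial path is $\overline{\{\eta_1,\dots,\eta_r\}}$. $W_x$ is dependent on $W_y$ if $P_x$ is a subcomplex of $P_y$. An $(m,n)$-simplicial cycle sequence is an $(m,n)$-walk sequence with $\sigma_{r+1}=\sigma_1$ and $\sigma_p\ne\sigma_q$, $\eta_p\ne\eta_q$ for $1\le p\ne q\le r$, such that $r\ge3$, $\sigma_1$ is not a face of $\eta_k$ for $2\le k\le r-1$, and condition (ii) above holds. $K$ is acyclic if it contains no $(m,n)$-simplicial cycle sequence for any $0\le m\le n-1$. -}

module Defs where

open import Data.Nat using (ℕ; zero; suc; _≤_; _<_; _∸_; s≤s)
open import Data.Nat.Properties using (<-trans; n<1+n; <⇒≤)
open import Data.Fin using (Fin; toℕ; fromℕ; fromℕ<; inject₁)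
import Data.Fin as F
open import Data.Fin.Subset using (Subset; _⊆_; ⁅_⁆; ∣_∣; Nonempty)
open import Data.Vec using (Vec; lookup)
open import Data.Product using (Σ; ∃; _×_)
open import Relation.Binary.PropositionalEquality using (_≡_; _≢_)
open import Relation.Nullary using (¬_)

record Complex (V : ℕ) : Set₁ where
  field
    Has        : Subset V → Set
    nonempty   : ∀ s → Has s → Nonempty s
    singletons : ∀ i → Has ⁅ i ⁆
    downClosed : ∀ s t → Has s → t ⊆ s → Nonempty t → Has t
open Complex public

IsSimplex : ∀ {V} → Complex V → ℕ → Subset V → Set
IsSimplex K k s = Has K s × ∣ s ∣ ≡ suc k

PureOfDim : ∀ {V} → Complex V → ℕ → Set
PureOfDim {V} K n =
  (∃ λ (s : Subset V) → IsSimplex K n s)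
  × (∀ s → Has K s → ∣ s ∣ ≤ suc n)
  × (∀ s → Has K s → ∃ λ η → IsSimplex K n η × s ⊆ η)

-- An alternating sequence σ_1, η_1, ..., σ_r, η_r, σ_{r+1}
-- (0-based: σs[0..r], ηs[0..r-1]).
record Seq (V : ℕ) : Set where
  constructor mkSeq
  field
    r  : ℕ
    σs : Vec (Subset V) (suc r)
    ηs : Vec (Subset V) r
open Seq public

first : ∀ {V} (W : Seq V) → Subset V
first W = lookup (σs W) F.zero

final : ∀ {V} (W : Seq V) → Subset V
final W = lookup (σs W) (fromℕ (r W))

IsWalk : ∀ {V} → Complex V → ℕ → ℕ → Seq V → Set
IsWalk K m n W =
  (∀ (k : Fin (suc (r W))) → IsSimplex K m (lookup (σs W) k))
  × (∀ (k : Fin (r W)) →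
       IsSimplex K n (lookup (ηs W) k)
       × lookup (σs W) (inject₁ k) ≢ lookup (σs W) (F.suc k)
       × lookup (σs W) (inject₁ k) ⊆ lookup (ηs W) k
       × lookup (σs W) (F.suc k) ⊆ lookup (ηs W) k)

WalkBetween : ∀ {V} → Complex V → ℕ → ℕ → Subset V → Subset V → Seq V → Set
WalkBetween K m n a b W = IsWalk K m n W × first W ≡ a × final W ≡ b

PathBetween : ∀ {V} → Complex V → ℕ → ℕ → Subset V → Subset V → Seq V → Set
PathBetween K m n a b W =
  WalkBetween K m n a b W
  × (∀ p q → lookup (σs W) p ≡ lookup (σs W) q → p ≡ q)
  × (∀ p q → lookup (ηs W) p ≡ lookup (ηs W) q → p ≡ q)
  × (∀ p q → lookup (σs W) p ≢ lookup (ηs W) q)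

-- Condition (ii): for each interior σ (1-based index z, 2 ≤ z ≤ r;
-- 0-based σ index suc z with η indices z and suc z, where suc z < r)
-- there is an (n-1)-simplex τ z of K that is a face of both adjacent
-- η's and contains σ, and these τ's are pairwise distinct.
CondII : ∀ {V} → Complex V → ℕ → Seq V → Set
CondII {V} K n W =
  Σ (ℕ → Subset V) λ τ →
    (∀ z (q : suc z < r W) →
        IsSimplex K (n ∸ 1) (τ z)
        × τ z ⊆ lookup (ηs W) (fromℕ< (<-trans (n<1+n z) q))
        × τ z ⊆ lookup (ηs W) (fromℕ< q)
        × lookup (σs W) (fromℕ< (s≤s (<⇒≤ q))) ⊆ τ z)
    × (∀ z w → suc z < r W → suc w < r W → τ z ≡ τ w → z ≡ w)

ReducedPath : ∀ {V} → Complex V → ℕ → ℕ → Subset V → Subset V → Seq V → Set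
ReducedPath K m n a b W =
  PathBetween K m n a b W
  × 1 ≤ r W
  × (∀ (k : Fin (r W)) → first W ⊆ lookup (ηs W) k → toℕ k ≡ 0)
  × (∀ (k : Fin (r W)) → final W ⊆ lookup (ηs W) k → suc (toℕ k) ≡ r W)
  × CondII K n W

-- The reduced simplicial path: closure of {η_1, ..., η_r}
-- (as a predicate on vertex subsets)
SPath : ∀ {V} → Seq V → Subset V → Set
SPath W s = Nonempty s × ∃ λ (k : Fin (r W)) → s ⊆ lookup (ηs W) k

Dependent : ∀ {V} → Seq V → Seq V → Set
Dependent Wx Wy = ∀ s → SPath Wx s → SPath Wy s

SamePath : ∀ {V} → Seq V → Seq V → Set
SamePath Wx Wy = ∀ s → (SPath Wx s → SPath Wy s) × (SPath Wy s → SPath Wx s)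

CycleSeq : ∀ {V} → Complex V → ℕ → ℕ → Seq V → Set
CycleSeq K m n W =
  IsWalk K m n W
  × final W ≡ first W
  × 3 ≤ r W
  × (∀ (p q : Fin (r W)) → lookup (σs W) (inject₁ p) ≡ lookup (σs W) (inject₁ q) → p ≡ q)
  × (∀ p q → lookup (ηs W) p ≡ lookup (ηs W) q → p ≡ q)
  × (∀ (k : Fin (r W)) → 1 ≤ toℕ k → suc (toℕ k) < r W → ¬ (first W ⊆ lookup (ηs W) k))
  × CondII K n W

Acyclic : ∀ {V} → Complex V → ℕ → Set
Acyclic K n = ∀ m → m < n → ¬ (∃ λ W → CycleSeq K m n W)

-- Both paths leave σi through their first n-simplex, so η^x_0 = η^y_0, and the
-- n-simplices of Wx then agree with those of Wy one by one. Otherwise some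
-- η^x_{k+1} = η^y_j with j ≥ k + 2, and the (n-1)-simplex τ^x_k, which is a
-- face of η^x_k = η^y_k and of η^x_{k+1}, lies in two non-adjacent n-simplices
-- of Wy. Taking two such occurrences with no occurrence in between, the
-- (n-1)-simplices τ^y joining consecutive n-simplices of Wy between them,
-- closed up by τ^x_k, form an (n-1,n)-simplicial cycle sequence, against
-- acyclicity. Hence Wx and Wy have the same n-simplices, i.e. the same
-- reduced simplicial path; when m = n-1 every interior σ is the common
-- facet of two distinct consecutive n-simplices, so the sequences coincide.
module Submission where

open import Defs
open import Data.Nat using (ℕ; zero; suc; _+_; _≤_; _<_; _∸_; z≤n; s≤s; _≤?_; _<?_)
open import Data.Nat.Properties
open import Data.Nat.Induction using (<-wellFounded)
open import Induction.WellFounded using (Acc; acc)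
open import Data.Fin as F using (Fin; toℕ; fromℕ; fromℕ<; inject₁)
open import Data.Fin.Properties using (toℕ-fromℕ<; toℕ-inject₁; toℕ-fromℕ; toℕ<n; toℕ-injective; any?)
open import Data.Fin.Subset using (Subset; _⊆_; ∣_∣; _∪_) renaming (⊥ to ∅)
open import Data.Fin.Subset.Properties using (p⊆q⇒∣p∣≤∣q∣; _⊆?_; ⊆-reflexive; p⊆p∪q; q⊆p∪q; x∈p∪q⁻; drop-∷-⊆)
open import Data.Bool using () renaming (true to inside; false to outside)
open import Data.Vec using (Vec; []; _∷_; lookup; tabulate; here)
open import Data.Vec.Properties using (lookup∘tabulate)
open import Data.Product using (∃; _×_; _,_; proj₁; proj₂)
open import Data.Sum using ([_,_]; inj₁; inj₂)
open import Data.Empty using (⊥; ⊥-elim)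
open import Function using (_∘_; id)
open import Relation.Binary.PropositionalEquality hiding ([_])
open import Relation.Nullary using (¬_; yes; no)
open import Relation.Binary.Definitions using (tri<; tri≈; tri>)

private
  variable
    V k m n n' i j : ℕ

⊆∧∣q∣≤∣p∣⇒≡ : {p q : Subset k} → p ⊆ q → ∣ q ∣ ≤ ∣ p ∣ → p ≡ q
⊆∧∣q∣≤∣p∣⇒≡ {p = []}          {[]}          _   _ = refl
⊆∧∣q∣≤∣p∣⇒≡ {p = outside ∷ p} {outside ∷ q} p⊆q c = cong (outside ∷_) (⊆∧∣q∣≤∣p∣⇒≡ (drop-∷-⊆ p⊆q) c)
⊆∧∣q∣≤∣p∣⇒≡ {p = outside ∷ p} {inside ∷ q}  p⊆q c = ⊥-elim (<⇒≱ (s≤s (p⊆q⇒∣p∣≤∣q∣ (drop-∷-⊆ p⊆q))) c)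
⊆∧∣q∣≤∣p∣⇒≡ {p = inside ∷ p}  {outside ∷ q} p⊆q c with p⊆q here
... | ()
⊆∧∣q∣≤∣p∣⇒≡ {p = inside ∷ p}  {inside ∷ q}  p⊆q c = cong (inside ∷_) (⊆∧∣q∣≤∣p∣⇒≡ (drop-∷-⊆ p⊆q) (≤-pred c))

∪-least : (p q : Subset k) {s : Subset k} → p ⊆ s → q ⊆ s → p ∪ q ⊆ s
∪-least p q p⊆s q⊆s x∈ = [ p⊆s , q⊆s ] (x∈p∪q⁻ p q x∈)

-- If A ≢ B then A ∪ B has k+1 elements, so it equals both E and G.
common-face-unique : {A B E G : Subset V}
  → ∣ A ∣ ≡ k → ∣ B ∣ ≡ k → ∣ E ∣ ≡ suc k → ∣ G ∣ ≡ suc k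
  → A ⊆ E → A ⊆ G → B ⊆ E → B ⊆ G → E ≢ G → A ≡ B
common-face-unique {k = k} {A} {B} {E} {G} ∣A∣ ∣B∣ ∣E∣ ∣G∣ A⊆E A⊆G B⊆E B⊆G E≢G with ∣ A ∪ B ∣ ≤? k
... | yes small = trans (⊆∧∣q∣≤∣p∣⇒≡ (p⊆p∪q B) (≤-trans small (≤-reflexive (sym ∣A∣))))
                       (sym (⊆∧∣q∣≤∣p∣⇒≡ (q⊆p∪q A B) (≤-trans small (≤-reflexive (sym ∣B∣)))))
... | no large = ⊥-elim (E≢G (trans (sym (union≡ A⊆E B⊆E ∣E∣)) (union≡ A⊆G B⊆G ∣G∣)))
  where
  union≡ : ∀ {S} → A ⊆ S → B ⊆ S → ∣ S ∣ ≡ suc k → A ∪ B ≡ S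
  union≡ A⊆S B⊆S ∣S∣ = ⊆∧∣q∣≤∣p∣⇒≡ (∪-least A B A⊆S B⊆S) (subst (_≤ ∣ A ∪ B ∣) (sym ∣S∣) (≰⇒> large))

-- Indices beyond the length read as the junk value ∅.
at : Vec (Subset V) k → ℕ → Subset V
at []      _       = ∅
at (s ∷ _) zero    = s
at (_ ∷ v) (suc i) = at v i

at-toℕ : (v : Vec (Subset V) k) (f : Fin k) → at v (toℕ f) ≡ lookup v f
at-toℕ (_ ∷ _) F.zero    = refl
at-toℕ (_ ∷ v) (F.suc f) = at-toℕ v f

lookup-fromℕ< : (v : Vec (Subset V) k) (p : i < k) → lookup v (fromℕ< p) ≡ at v i
lookup-fromℕ< v p = trans (sym (at-toℕ v (fromℕ< p))) (cong (at v) (toℕ-fromℕ< p))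

lookup-inject₁-fromℕ< : (v : Vec (Subset V) (suc k)) (p : i < k) → lookup v (inject₁ (fromℕ< p)) ≡ at v i
lookup-inject₁-fromℕ< v p = trans (sym (at-toℕ v _)) (cong (at v) (trans (toℕ-inject₁ _) (toℕ-fromℕ< p)))

at-ext : (v w : Vec (Subset V) k) → (∀ {i} → i < k → at v i ≡ at w i) → v ≡ w
at-ext []      []      _ = refl
at-ext (x ∷ v) (y ∷ w) h = cong₂ _∷_ (h (s≤s z≤n)) (at-ext v w (h ∘ s≤s))

tab : (ℕ → Subset V) → Vec (Subset V) k
tab f = tabulate (f ∘ toℕ)

lookup-tab : (f : ℕ → Subset V) (x : Fin k) → lookup (tab f) x ≡ f (toℕ x)
lookup-tab f = lookup∘tabulate (f ∘ toℕ)

lookup-tab-inject₁ : (f : ℕ → Subset V) (x : Fin k) → lookup (tab f) (inject₁ x) ≡ f (toℕ x)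
lookup-tab-inject₁ f x = trans (lookup-tab f (inject₁ x)) (cong f (toℕ-inject₁ x))

lookup-tab-fromℕ< : (f : ℕ → Subset V) (p : i < k) → lookup (tab f) (fromℕ< p) ≡ f i
lookup-tab-fromℕ< f p = trans (lookup-tab f (fromℕ< p)) (cong f (toℕ-fromℕ< p))

mkSeq-≡ : ∀ {r} {σv : Vec (Subset V) (suc r)} {σv' : Vec (Subset V) (suc n)} {ηv : Vec (Subset V) r} {ηv' : Vec (Subset V) n}
  → r ≡ n → (∀ {i} → i ≤ r → at σv i ≡ at σv' i) → (∀ {i} → i < r → at ηv i ≡ at ηv' i)
  → mkSeq r σv ηv ≡ mkSeq n σv' ηv'
mkSeq-≡ refl hσ hη = cong₂ (mkSeq _) (at-ext _ _ (hσ ∘ ≤-pred)) (at-ext _ _ hη)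

samePath : ∀ {r} {σv : Vec (Subset V) (suc r)} {σv' : Vec (Subset V) (suc n)} {ηv : Vec (Subset V) r} {ηv' : Vec (Subset V) n}
  → r ≡ n → (∀ {i} → i < r → at ηv i ≡ at ηv' i) → SamePath (mkSeq r σv ηv) (mkSeq n σv' ηv')
samePath {σv = σv} {σv'} {ηv} {ηv'} refl hη =
  subst (λ η → SamePath (mkSeq _ σv ηv) (mkSeq _ σv' η)) (at-ext ηv ηv' hη) (λ _ → id , id)

record Walkℕ (K : Complex V) (m n r : ℕ) (σ η : ℕ → Subset V) : Set where
  field
    σ-simplex : i ≤ r → IsSimplex K m (σ i)
    η-simplex : i < r → IsSimplex K n (η i)
    σ≢σ-next  : i < r → σ i ≢ σ (suc i)
    σ⊆η       : i < r → σ i ⊆ η i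
    σ-next⊆η  : i < r → σ (suc i) ⊆ η i

record CondIIℕ (K : Complex V) (n r : ℕ) (σ η τ : ℕ → Subset V) : Set where
  field
    τ-simplex   : suc i < r → IsSimplex K (n ∸ 1) (τ i)
    τ⊆η         : suc i < r → τ i ⊆ η i
    τ⊆η-next    : suc i < r → τ i ⊆ η (suc i)
    σ⊆τ         : suc i < r → σ (suc i) ⊆ τ i
    τ-injective : suc i < r → suc j < r → τ i ≡ τ j → i ≡ j

record ReducedPathℕ (K : Complex V) (m n : ℕ) (a b : Subset V) (r : ℕ) (σ η : ℕ → Subset V) : Set where
  field
    walk          : Walkℕ K m n r σ η
    η-injective   : i < r → j < r → η i ≡ η j → i ≡ j
    σ-first       : σ 0 ≡ a
    σ-last        : σ r ≡ b
    1≤r           : 1 ≤ r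
    first-only-η₀ : i < r → a ⊆ η i → i ≡ 0
    last-only-ηᵣ  : i < r → b ⊆ η i → suc i ≡ r
    τ             : ℕ → Subset V
    condII        : CondIIℕ K n r σ η τ
  open Walkℕ walk public
  open CondIIℕ condII public

record CycleSeqℕ (K : Complex V) (m n R : ℕ) (σ η : ℕ → Subset V) : Set where
  field
    walk                  : Walkℕ K m n R σ η
    closed                : σ R ≡ σ 0
    3≤R                   : 3 ≤ R
    σ-injective           : i < R → j < R → σ i ≡ σ j → i ≡ j
    η-injective           : i < R → j < R → η i ≡ η j → i ≡ j
    first-avoids-interior : 1 ≤ i → suc i < R → ¬ (σ 0 ⊆ η i)
    τ                     : ℕ → Subset V
    condII                : CondIIℕ K n R σ η τ

module _ {K : Complex V} where

  isWalk⇒Walkℕ : ∀ {r} {σv : Vec (Subset V) (suc r)} {ηv : Vec (Subset V) r}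
    → IsWalk K m n (mkSeq r σv ηv) → Walkℕ K m n r (at σv) (at ηv)
  isWalk⇒Walkℕ {m = m} {n = n} {σv = σv} {ηv} (σ-ok , η-ok) = record
    { σ-simplex = λ p → subst (IsSimplex K m) (lookup-fromℕ< σv (s≤s p)) (σ-ok (fromℕ< (s≤s p)))
    ; η-simplex = λ p → subst (IsSimplex K n) (lookup-fromℕ< ηv p) (proj₁ (η-ok (fromℕ< p)))
    ; σ≢σ-next  = λ p e → proj₁ (proj₂ (η-ok (fromℕ< p)))
                    (trans (lookup-inject₁-fromℕ< σv p) (trans e (sym (lookup-fromℕ< σv (s≤s p)))))
    ; σ⊆η       = λ p → subst₂ _⊆_ (lookup-inject₁-fromℕ< σv p) (lookup-fromℕ< ηv p)
                          (proj₁ (proj₂ (proj₂ (η-ok (fromℕ< p)))))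
    ; σ-next⊆η  = λ p → subst₂ _⊆_ (lookup-fromℕ< σv (s≤s p)) (lookup-fromℕ< ηv p)
                          (proj₂ (proj₂ (proj₂ (η-ok (fromℕ< p)))))
    }

  condII⇒CondIIℕ : ∀ {r} {σv : Vec (Subset V) (suc r)} {ηv : Vec (Subset V) r}
    → (c : CondII K n (mkSeq r σv ηv)) → CondIIℕ K n r (at σv) (at ηv) (proj₁ c)
  condII⇒CondIIℕ {σv = σv} {ηv} (τ , τ-ok , τ-inj) = record
    { τ-simplex   = λ q → proj₁ (τ-ok _ q)
    ; τ⊆η         = λ q → subst (τ _ ⊆_) (lookup-fromℕ< ηv (<-trans (n<1+n _) q)) (proj₁ (proj₂ (τ-ok _ q)))
    ; τ⊆η-next    = λ q → subst (τ _ ⊆_) (lookup-fromℕ< ηv q) (proj₁ (proj₂ (proj₂ (τ-ok _ q))))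
    ; σ⊆τ         = λ q → subst (_⊆ τ _) (lookup-fromℕ< σv (s≤s (<⇒≤ q))) (proj₂ (proj₂ (proj₂ (τ-ok _ q))))
    ; τ-injective = τ-inj _ _
    }

  reducedPathℕ : ∀ {r} {a b : Subset V} {σv : Vec (Subset V) (suc r)} {ηv : Vec (Subset V) r}
    → ReducedPath K m n a b (mkSeq r σv ηv) → ReducedPathℕ K m n a b r (at σv) (at ηv)
  reducedPathℕ {r = r} {σv = σv} {ηv} ((((walk , first≡ , final≡) , _ , η-inj , _) , 1≤r , only-first , only-last , cond)) = record
    { walk          = isWalk⇒Walkℕ {σv = σv} {ηv} walk
    ; η-injective   = λ p q e → trans (sym (toℕ-fromℕ< p)) (trans (cong toℕ (η-inj (fromℕ< p) (fromℕ< q)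
                        (trans (lookup-fromℕ< ηv p) (trans e (sym (lookup-fromℕ< ηv q)))))) (toℕ-fromℕ< q))
    ; σ-first       = trans (at-toℕ σv F.zero) first≡
    ; σ-last        = trans (cong (at σv) (sym (toℕ-fromℕ r))) (trans (at-toℕ σv (fromℕ r)) final≡)
    ; 1≤r           = 1≤r
    ; first-only-η₀ = λ p a⊆ → trans (sym (toℕ-fromℕ< p)) (only-first (fromℕ< p) (subst₂ _⊆_ (sym first≡) (sym (lookup-fromℕ< ηv p)) a⊆))
    ; last-only-ηᵣ  = λ p b⊆ → trans (cong suc (sym (toℕ-fromℕ< p))) (only-last (fromℕ< p) (subst₂ _⊆_ (sym final≡) (sym (lookup-fromℕ< ηv p)) b⊆))
    ; τ             = proj₁ cond
    ; condII        = condII⇒CondIIℕ {σv = σv} {ηv} cond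
    }

  Walkℕ⇒isWalk : ∀ {R} {σ η : ℕ → Subset V} → Walkℕ K m n R σ η → IsWalk K m n (mkSeq R (tab σ) (tab η))
  Walkℕ⇒isWalk {m = m} {n = n} {σ = σ} {η} w =
      (λ x → subst (IsSimplex K m) (sym (lookup-tab σ x)) (σ-simplex (≤-pred (toℕ<n x))))
    , (λ x → subst (IsSimplex K n) (sym (lookup-tab η x)) (η-simplex (toℕ<n x))
           , (λ e → σ≢σ-next (toℕ<n x) (trans (sym (lookup-tab-inject₁ σ x)) (trans e (lookup-tab σ (F.suc x)))))
           , subst₂ _⊆_ (sym (lookup-tab-inject₁ σ x)) (sym (lookup-tab η x)) (σ⊆η (toℕ<n x))
           , subst₂ _⊆_ (sym (lookup-tab σ (F.suc x))) (sym (lookup-tab η x)) (σ-next⊆η (toℕ<n x)))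
    where open Walkℕ w

  CondIIℕ⇒condII : ∀ {R} {σ η τ : ℕ → Subset V} → CondIIℕ K n R σ η τ → CondII K n (mkSeq R (tab σ) (tab η))
  CondIIℕ⇒condII {σ = σ} {η} {τ} c =
      τ
    , (λ z q → τ-simplex q
             , subst (τ z ⊆_) (sym (lookup-tab-fromℕ< η (<-trans (n<1+n z) q))) (τ⊆η q)
             , subst (τ z ⊆_) (sym (lookup-tab-fromℕ< η q)) (τ⊆η-next q)
             , subst (_⊆ τ z) (sym (lookup-tab-fromℕ< σ (s≤s (<⇒≤ q)))) (σ⊆τ q))
    , (λ _ _ → τ-injective)
    where open CondIIℕ c

  cycleSeq : ∀ {R} {σ η : ℕ → Subset V} → CycleSeqℕ K m n R σ η → CycleSeq K m n (mkSeq R (tab σ) (tab η))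
  cycleSeq {R = R} {σ} {η} c =
      Walkℕ⇒isWalk walk
    , trans (lookup-tab σ (fromℕ R)) (trans (cong σ (toℕ-fromℕ R)) closed)
    , 3≤R
    , (λ x y e → toℕ-injective (σ-injective (toℕ<n x) (toℕ<n y)
                   (trans (sym (lookup-tab-inject₁ σ x)) (trans e (lookup-tab-inject₁ σ y)))))
    , (λ x y e → toℕ-injective (η-injective (toℕ<n x) (toℕ<n y)
                   (trans (sym (lookup-tab η x)) (trans e (lookup-tab η y)))))
    , (λ x 1≤x q σ₀⊆ → first-avoids-interior 1≤x q (subst (σ 0 ⊆_) (lookup-tab η x) σ₀⊆))
    , CondIIℕ⇒condII condII
    where open CycleSeqℕ c

module NoRevisit {K : Complex V} (acyclic : Acyclic K (suc n')) {s t : Subset V} {r} {σ η : ℕ → Subset V}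
  (P : ReducedPathℕ K m (suc n') s t r σ η) {τ₀ : Subset V} (τ₀-simplex : IsSimplex K n' τ₀) where
  open ReducedPathℕ P

  ⊆-consecutive⇒≡τ : ∀ {c} → suc c < r → τ₀ ⊆ η c → τ₀ ⊆ η (suc c) → τ₀ ≡ τ c
  ⊆-consecutive⇒≡τ q h h' = common-face-unique (proj₂ τ₀-simplex) (proj₂ (τ-simplex q))
    (proj₂ (η-simplex (<-trans (n<1+n _) q))) (proj₂ (η-simplex q)) h h' (τ⊆η q) (τ⊆η-next q)
    (λ e → <-irrefl (η-injective (<-trans (n<1+n _) q) q e) (n<1+n _))

  ¬⊆-three-consecutive : ∀ {c} → suc (suc c) < r → τ₀ ⊆ η c → τ₀ ⊆ η (suc c) → τ₀ ⊆ η (suc (suc c)) → ⊥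
  ¬⊆-three-consecutive q h₀ h₁ h₂ =
    <-irrefl (τ-injective q' q (trans (sym (⊆-consecutive⇒≡τ q' h₀ h₁)) (⊆-consecutive⇒≡τ q h₁ h₂))) (n<1+n _)
    where
    q' = <-trans (n<1+n _) q

  -- The cycle τ₀, τ_c, …, τ_{c+d-1}, τ₀ through η_c, …, η_{c+d}.
  module Loop {c d} (2≤d : 2 ≤ d) (bound : c + d < r) (⊆η-start : τ₀ ⊆ η c) (⊆η-end : τ₀ ⊆ η (c + d))
              (gap : ∀ {i} → 1 ≤ i → i < d → ¬ (τ₀ ⊆ η (c + i))) where

    loopσ : ℕ → Subset V
    loopσ zero = τ₀
    loopσ (suc i) with i <? d
    ... | yes _ = τ (c + i)
    ... | no _  = τ₀

    loopσ-interior : i < d → loopσ (suc i) ≡ τ (c + i)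
    loopσ-interior {i} p with i <? d
    ... | yes _ = refl
    ... | no ¬p = ⊥-elim (¬p p)

    loopσ-closed : loopσ (suc d) ≡ τ₀
    loopσ-closed with d <? d
    ... | yes p = ⊥-elim (<-irrefl refl p)
    ... | no _  = refl

    τ-bound : i < d → suc (c + i) < r
    τ-bound {i} p = ≤-<-trans (subst (_≤ c + d) (+-suc c i) (+-monoʳ-≤ c p)) bound

    η-bound : i ≤ d → c + i < r
    η-bound p = ≤-<-trans (+-monoʳ-≤ c p) bound

    τ₀≢τ : i < d → τ₀ ≢ τ (c + i)
    τ₀≢τ {zero}  p e = gap (s≤s z≤n) 2≤d
      (subst₂ (λ x y → x ⊆ η y) (sym e) (sym (+-suc c 0)) (τ⊆η-next (τ-bound p)))
    τ₀≢τ {suc i} p e = gap (s≤s z≤n) p (subst (_⊆ η (c + suc i)) (sym e) (τ⊆η (τ-bound p)))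

    loopσ-simplex : i ≤ suc d → IsSimplex K n' (loopσ i)
    loopσ-simplex {zero}  _ = τ₀-simplex
    loopσ-simplex {suc i} _ with i <? d
    ... | yes p = τ-simplex (τ-bound p)
    ... | no _  = τ₀-simplex

    loopσ≢next : i < suc d → loopσ i ≢ loopσ (suc i)
    loopσ≢next {zero} _ e = τ₀≢τ (≤-trans (s≤s z≤n) 2≤d) (trans e (loopσ-interior (≤-trans (s≤s z≤n) 2≤d)))
    loopσ≢next {suc i} p e with suc i <? d
    ... | yes q = <-irrefl (+-cancelˡ-≡ c _ _ (τ-injective (τ-bound (≤-pred p)) (τ-bound q)
                    (trans (sym (loopσ-interior (≤-pred p))) e))) (n<1+n i)
    ... | no _  = τ₀≢τ (≤-pred p) (trans (sym e) (loopσ-interior (≤-pred p)))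

    loopσ⊆η : i < suc d → loopσ i ⊆ η (c + i)
    loopσ⊆η {zero}  _ = subst (λ x → τ₀ ⊆ η x) (sym (+-identityʳ c)) ⊆η-start
    loopσ⊆η {suc i} p = subst₂ (λ x y → x ⊆ η y) (sym (loopσ-interior (≤-pred p))) (sym (+-suc c i))
      (τ⊆η-next (τ-bound (≤-pred p)))

    loopσ-next⊆η : i < suc d → loopσ (suc i) ⊆ η (c + i)
    loopσ-next⊆η {i} p with i <? d
    ... | yes q  = τ⊆η (τ-bound q)
    ... | no i≮d = subst (λ x → τ₀ ⊆ η (c + x)) (sym (≤-antisym (≤-pred p) (≮⇒≥ i≮d))) ⊆η-end

    loopσ-injective : i < suc d → j < suc d → loopσ i ≡ loopσ j → i ≡ j
    loopσ-injective {zero}  {zero}  _ _ _ = refl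
    loopσ-injective {zero}  {suc j} _ q e = ⊥-elim (τ₀≢τ (≤-pred q) (trans e (loopσ-interior (≤-pred q))))
    loopσ-injective {suc i} {zero}  p _ e = ⊥-elim (τ₀≢τ (≤-pred p) (trans (sym e) (loopσ-interior (≤-pred p))))
    loopσ-injective {suc i} {suc j} p q e = cong suc (+-cancelˡ-≡ c _ _
      (τ-injective (τ-bound (≤-pred p)) (τ-bound (≤-pred q))
        (trans (sym (loopσ-interior (≤-pred p))) (trans e (loopσ-interior (≤-pred q))))))

    cycle : CycleSeqℕ K n' (suc n') (suc d) loopσ (λ i → η (c + i))
    cycle = record
      { walk = record
        { σ-simplex = loopσ-simplex
        ; η-simplex = λ p → η-simplex (η-bound (≤-pred p))
        ; σ≢σ-next  = loopσ≢next
        ; σ⊆η       = loopσ⊆η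
        ; σ-next⊆η  = loopσ-next⊆η
        }
      ; closed                = loopσ-closed
      ; 3≤R                   = s≤s 2≤d
      ; σ-injective           = loopσ-injective
      ; η-injective           = λ p q e → +-cancelˡ-≡ c _ _ (η-injective (η-bound (≤-pred p)) (η-bound (≤-pred q)) e)
      ; first-avoids-interior = λ 1≤i q → gap 1≤i (≤-pred q)
      ; τ                     = λ i → τ (c + i)
      ; condII = record
        { τ-simplex   = λ q → τ-simplex (τ-bound (≤-pred q))
        ; τ⊆η         = λ q → τ⊆η (τ-bound (≤-pred q))
        ; τ⊆η-next    = λ {i} q → subst (λ x → τ (c + i) ⊆ η x) (sym (+-suc c i)) (τ⊆η-next (τ-bound (≤-pred q)))
        ; σ⊆τ         = λ q → ⊆-reflexive (loopσ-interior (≤-pred q))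
        ; τ-injective = λ p q e → +-cancelˡ-≡ c _ _ (τ-injective (τ-bound (≤-pred p)) (τ-bound (≤-pred q)) e)
        }
      }

    impossible : ⊥
    impossible = acyclic n' (n<1+n n') (mkSeq (suc d) (tab loopσ) (tab (λ i → η (c + i))) , cycleSeq cycle)

  -- Induction on the distance e + 2. Without an occurrence of τ₀ strictly in
  -- between, Loop applies; an inner occurrence gives a shorter distance unless
  -- it makes three consecutive ones.
  ¬⊆-apart-by : ∀ {e} → Acc _<_ e → ∀ {c} → c + suc (suc e) < r
    → τ₀ ⊆ η c → τ₀ ⊆ η (c + suc (suc e)) → ⊥
  ¬⊆-apart-by {e} (acc rec) {c} bound h h' with any? (λ (x : Fin (suc e)) → τ₀ ⊆? η (c + suc (toℕ x)))
  ... | no none = Loop.impossible (s≤s (s≤s z≤n)) bound h h' gap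
    where
    gap : ∀ {i} → 1 ≤ i → i < suc (suc e) → ¬ (τ₀ ⊆ η (c + i))
    gap {suc i} _ i<d h-mid =
      none (fromℕ< (≤-pred i<d) , subst (λ x → τ₀ ⊆ η (c + suc x)) (sym (toℕ-fromℕ< (≤-pred i<d))) h-mid)
  ... | yes (F.suc x , h-mid) =
    ¬⊆-apart-by (rec (toℕ<n x)) (≤-<-trans (+-monoʳ-≤ c (s≤s (s≤s (<⇒≤ (toℕ<n x))))) bound) h h-mid
  ¬⊆-apart-by {zero} _ {c} bound h h' | yes (F.zero , h₁) =
    ¬⊆-three-consecutive (subst (_< r) (+-comm c 2) bound) h
      (subst (λ x → τ₀ ⊆ η x) (+-comm c 1) h₁) (subst (λ x → τ₀ ⊆ η x) (+-comm c 2) h')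
  ¬⊆-apart-by {suc e} (acc rec) {c} bound h h' | yes (F.zero , h₁) =
    ¬⊆-apart-by (rec (n<1+n e)) (subst (_< r) (+-suc c _) bound) (subst (λ x → τ₀ ⊆ η x) (+-comm c 1) h₁)
      (subst (λ x → τ₀ ⊆ η x) (+-suc c _) h')

  ¬⊆-apart : ∀ {c c'} → suc c < c' → c' < r → τ₀ ⊆ η c → τ₀ ⊆ η c' → ⊥
  ¬⊆-apart {c} c+1<c' c'<r h h' with m≤n⇒∃[o]m+o≡n c+1<c'
  ... | e , refl = ¬⊆-apart-by (<-wellFounded e) (subst (_< r) (sym shift) c'<r) h (subst (λ x → τ₀ ⊆ η x) (sym shift) h')
    where
    shift : c + suc (suc e) ≡ suc (suc c) + e
    shift = trans (+-suc c (suc e)) (cong suc (+-suc c e))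

dependent⇒η-in : ∀ {K : Complex V} {m m' n rx ry} {σvx : Vec (Subset V) (suc rx)} {ηvx : Vec (Subset V) rx}
  {σvy : Vec (Subset V) (suc ry)} {ηvy : Vec (Subset V) ry} {σx σy : ℕ → Subset V}
  → Walkℕ K m n rx σx (at ηvx) → Walkℕ K m' n ry σy (at ηvy)
  → Dependent (mkSeq rx σvx ηvx) (mkSeq ry σvy ηvy)
  → ∀ {i} → i < rx → ∃ λ j → j < ry × at ηvx i ≡ at ηvy j
dependent⇒η-in {K = K} {ηvx = ηvx} {ηvy = ηvy} X Y dep {i} p
  with dep (at ηvx i) (nonempty K _ (proj₁ (X.η-simplex p)) , fromℕ< p , ⊆-reflexive (sym (lookup-fromℕ< ηvx p)))
  where
  module X = Walkℕ X
... | _ , x , ⊆ηy = toℕ x , toℕ<n x ,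
  ⊆∧∣q∣≤∣p∣⇒≡ (subst (at ηvx i ⊆_) (sym (at-toℕ ηvy x)) ⊆ηy)
    (≤-reflexive (trans (proj₂ (Walkℕ.η-simplex Y (toℕ<n x))) (sym (proj₂ (Walkℕ.η-simplex X p)))))

module Agreement {K : Complex V} (acyclic : Acyclic K (suc n')) {s t : Subset V} {rx ry} {σx ηx σy ηy : ℕ → Subset V}
  (X : ReducedPathℕ K m (suc n') s t rx σx ηx) (Y : ReducedPathℕ K m (suc n') s t ry σy ηy)
  (η-in : ∀ {i} → i < rx → ∃ λ j → j < ry × ηx i ≡ ηy j) where
  module X = ReducedPathℕ X
  module Y = ReducedPathℕ Y

  η-agree-acc : Acc _<_ i → i < rx → i < ry × ηx i ≡ ηy i
  η-agree-acc {zero} _ p with η-in p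
  ... | j , j<ry , ηx≡ηy = subst (λ j → j < ry × ηx 0 ≡ ηy j) j≡0 (j<ry , ηx≡ηy)
    where
    j≡0 : j ≡ 0
    j≡0 = Y.first-only-η₀ j<ry (subst₂ _⊆_ X.σ-first ηx≡ηy (X.σ⊆η p))
  η-agree-acc {suc k} (acc rec) p with η-in p
  ... | j , j<ry , ηx≡ηy with <-cmp j (suc k)
  ... | tri< j<i _ _ = ⊥-elim (<-irrefl (sym (X.η-injective p (<-trans j<i p)
          (trans ηx≡ηy (sym (proj₂ (η-agree-acc (rec j<i) (<-trans j<i p))))))) j<i)
  ... | tri≈ _ refl _ = j<ry , ηx≡ηy
  ... | tri> _ _ i<j = ⊥-elim (NoRevisit.¬⊆-apart acyclic Y (X.τ-simplex p) i<j j<ry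
          (subst (X.τ k ⊆_) (proj₂ previous) (X.τ⊆η p)) (subst (X.τ k ⊆_) ηx≡ηy (X.τ⊆η-next p)))
    where
    previous = η-agree-acc (rec (n<1+n k)) (<-trans (n<1+n k) p)

  η-agree : i < rx → i < ry × ηx i ≡ ηy i
  η-agree = η-agree-acc (<-wellFounded _)

  length-agree : rx ≡ ry
  length-agree = trans (sym rx≡) (Y.last-only-ηᵣ (proj₁ last)
    (subst₂ _⊆_ (trans (cong σx rx≡) X.σ-last) (proj₂ last) (X.σ-next⊆η (≤-reflexive rx≡))))
    where
    rx≡ : suc (rx ∸ 1) ≡ rx
    rx≡ = m+[n∸m]≡n X.1≤r
    last = η-agree (≤-reflexive rx≡)

  σ-agree : m ≡ n' → ∀ {i} → i ≤ rx → σx i ≡ σy i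
  σ-agree _ {zero} _ = trans X.σ-first (sym Y.σ-first)
  σ-agree m≡n' {suc j} p with m≤n⇒m<n∨m≡n p
  ... | inj₂ e = trans (cong σx e) (trans X.σ-last (sym (trans (cong σy (trans e length-agree)) Y.σ-last)))
  ... | inj₁ sj<rx = common-face-unique
    (trans (proj₂ (X.σ-simplex p)) (cong suc m≡n'))
    (trans (proj₂ (Y.σ-simplex (subst (suc j ≤_) length-agree p))) (cong suc m≡n'))
    (proj₂ (X.η-simplex j<rx)) (proj₂ (X.η-simplex sj<rx))
    (X.σ-next⊆η j<rx) (X.σ⊆η sj<rx)
    (subst (σy (suc j) ⊆_) (sym (proj₂ (η-agree j<rx))) (Y.σ-next⊆η (proj₁ (η-agree j<rx))))
    (subst (σy (suc j) ⊆_) (sym (proj₂ (η-agree sj<rx))) (Y.σ⊆η (proj₁ (η-agree sj<rx))))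
    (λ e → <-irrefl (X.η-injective j<rx sj<rx e) (n<1+n j))
    where
    j<rx = <-trans (n<1+n j) sj<rx

lemma4p1 : ∀ {V : ℕ} (K : Complex V) (n m : ℕ) → 1 ≤ n → m ≤ n ∸ 1
    → PureOfDim K n → Acyclic K n
    → (σi σj : Subset V) → IsSimplex K m σi → IsSimplex K m σj
    → (Wx Wy : Seq V)
    → ReducedPath K m n σi σj Wx → ReducedPath K m n σi σj Wy
    → Dependent Wx Wy
    → (m ≡ n ∸ 1 → Wx ≡ Wy) × (m < n ∸ 1 → SamePath Wx Wy)
lemma4p1 K zero m ()
lemma4p1 K (suc n') m _ _ _ acyclic _ _ _ _ (mkSeq rx σvx ηvx) (mkSeq ry σvy ηvy) Rx Ry dep =
    (λ m≡n' → mkSeq-≡ A.length-agree (A.σ-agree m≡n') (λ p → proj₂ (A.η-agree p)))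
  , (λ _ → samePath {σv = σvx} {σvy} {ηvx} {ηvy} A.length-agree (λ p → proj₂ (A.η-agree p)))
  where
  X = reducedPathℕ {K = K} {σv = σvx} {ηvx} Rx
  Y = reducedPathℕ {K = K} {σv = σvy} {ηvy} Ry
  module A = Agreement acyclic X Y
    (dependent⇒η-in {σvx = σvx} {ηvx} {σvy} {ηvy} (ReducedPathℕ.walk X) (ReducedPathℕ.walk Y) dep)
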